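{- Consider the following procedure, run on a lattice $\Lambda=\Lambda(A)$ and target $t$ with $1\le d(t,\Lambda)\le 2^{cn^2 b}$, where $d(t,\Lambda)=\min_{w\in\Lambda}\|w-t\|_\infty$, given $\varepsilon\in(0,1)$ and an oracle for $(1+\delta)$-gap $\mathrm{CVP}_\infty$: (1) set $\delta:=\min\{\varepsilon/5,1/2\}$; (2) set $L\gets 0$ and $U\gets\lceil\log_{1+\delta}2^{cn^2 b}\rceil$; (3) while $U-L\ge 3$: call the $(1+\delta)$-gap oracle on input $(A,t,(1+\delta)^{L+\lceil(U-L)/2\rceil})$; if it returns a lattice vector $v$, set $U\gets\lceil\log_{1+\delta}\|v-t\|_\infty\rceil$; otherwise set $L\gets L+\lceil(U-L)/2\rceil-1$; (4) call the $(1+\delta)$-gap oracle on input $(A,t,(1+\delta)^{U+1})$ and return the resulting lattice vector. Then: (i) throughout the while-loop the invariant $(1+\delta)^L\le d(t,\Lambda)\le(1+\delta)^U$ is maintained; (ii) the procedure returns a lattice vector $v$ satisfying $\|v-t\|_\infty\le(1+\varepsilon)\,d(t,\Lambda)$.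
   Context: For $A\in\mathbb{Q}^{n\times n}$, $\Lambda(A)=\{Ax:x\in\mathbb{Z}^n\}$; $b$ is the binary encoding length of $(A,t)$ and $c>0$ is a fixed constant. For $\alpha\ge1$, the $\alpha$-gap $\mathrm{CVP}_\infty$ problem is: given $\Lambda(A)$, $t$ and $D>0$, either return a lattice vector $v$ with $\|v-t\|_\infty\le D$, or assert that all $v\in\Lambda(A)$ satisfy $\|v-t\|_\infty>\alpha^{ -1}D$. -}

module Defs where

open import Data.Nat as ℕ using (ℕ; zero; suc; ⌈_/2⌉; _∸_)
open import Data.Integer as ℤ using (ℤ; +_)
open import Data.Fin using (Fin)
open import Data.Maybe using (Maybe; just; nothing)
open import Data.Product using (_×_; ∃)
open import Data.Rational as ℚ using (ℚ; 0ℚ; 1ℚ; ½; _+_; _*_; _-_; _≤_; _<_; _⊔_; _⊓_; ∣_∣; _/_)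
import Data.Vec.Functional as VF

Vecℚ : ℕ → Set
Vecℚ n = Fin n → ℚ

Mat : ℕ → Set
Mat n = Fin n → Fin n → ℚ

Σℚ : ∀ {n} → (Fin n → ℚ) → ℚ
Σℚ f = VF.foldr _+_ 0ℚ f

_·_ : ∀ {n} → Mat n → (Fin n → ℤ) → Vecℚ n
(A · x) i = Σℚ (λ j → A i j * (x j / 1))

‖_‖∞ : ∀ {n} → Vecℚ n → ℚ
‖ v ‖∞ = VF.foldr (λ a m → ∣ a ∣ ⊔ m) 0ℚ v

_⊖_ : ∀ {n} → Vecℚ n → Vecℚ n → Vecℚ n
(u ⊖ v) i = u i - v i

dist : ∀ {n} → Mat n → Vecℚ n → (Fin n → ℤ) → ℚ
dist A t x = ‖ (A · x) ⊖ t ‖∞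

IsDist : ∀ {n} → Mat n → Vecℚ n → ℚ → Set
IsDist A t r = ∃ (λ x → dist A t x ≡′ r) × (∀ y → r ≤ dist A t y)
  where open import Relation.Binary.PropositionalEquality using () renaming (_≡_ to _≡′_)

_^_ : ℚ → ℕ → ℚ
q ^ zero  = 1ℚ
q ^ suc k = q * (q ^ k)

-- k = ⌈ log_β x ⌉  (for x ≥ 1; k is the least natural number with x ≤ β^k)
IsCeilLog : ℚ → ℚ → ℕ → Set
IsCeilLog β x k = (x ≤ β ^ k) × (∀ j → j ℕ.< k → β ^ j < x)

δof : ℚ → ℚ
δof ε = (ε * (+ 1 / 5)) ⊓ ½

-- valid answers of an α-gap CVP∞ oracle on input (A, t, D):
-- either a lattice vector A x (given by its coefficients x) with ‖Ax − t‖ ≤ D,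
-- or "no", which requires every lattice vector to satisfy ‖Ay − t‖ > D/α.
ValidAnswer : ∀ {n} → Mat n → Vecℚ n → ℚ → ℚ → Maybe (Fin n → ℤ) → Set
ValidAnswer A t α D (just x) = dist A t x ≤ D
ValidAnswer A t α D nothing  = ∀ y → D < α * dist A t y

record State : Set where
  constructor ⟨_,_⟩
  field
    L : ℕ
    U : ℕ
open State public

mid : State → ℕ
mid s = L s ℕ.+ ⌈ (U s ∸ L s) /2⌉

data Step {n} (A : Mat n) (t : Vecℚ n) (β : ℚ) : State → State → Set where
  found : ∀ {Lc Uc k} (x : Fin n → ℤ) →
          3 ℕ.≤ Uc ∸ Lc →
          ValidAnswer A t β (β ^ mid ⟨ Lc , Uc ⟩) (just x) →
          IsCeilLog β (dist A t x) k →
          Step A t β ⟨ Lc , Uc ⟩ ⟨ Lc , k ⟩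
  notFound : ∀ {Lc Uc} →
          3 ℕ.≤ Uc ∸ Lc →
          ValidAnswer A t β (β ^ mid ⟨ Lc , Uc ⟩) nothing →
          Step A t β ⟨ Lc , Uc ⟩ ⟨ mid ⟨ Lc , Uc ⟩ ∸ 1 , Uc ⟩

-- States reachable by the loop from the initialisation L = 0, U = ⌈log_β M⌉,
-- where M = 2^{c n² b} is the a-priori upper bound on d(t, Λ).
data Reach {n} (A : Mat n) (t : Vecℚ n) (β M : ℚ) : State → Set where
  init : ∀ {U₀} → IsCeilLog β M U₀ → Reach A t β M ⟨ 0 , U₀ ⟩
  step : ∀ {s s'} → Reach A t β M s → Step A t β s s' → Reach A t β M s'

-- Binary search on the exponent k in D = (1+δ)^k.  A "yes" answer v at exponent m
-- gives d(t,Λ) ≤ ‖v − t‖ ≤ (1+δ)^m, a "no" answer gives (1+δ)^(m−1) ≤ d(t,Λ), so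
-- the bracket (1+δ)^L ≤ d(t,Λ) ≤ (1+δ)^U survives every step while U − L strictly
-- shrinks.  Once U ≤ L + 2, the final query at (1+δ)^(U+1) must say yes (a "no"
-- would force (1+δ)^U < d(t,Λ)), and its answer is within (1+δ)^3 d(t,Λ) of t;
-- finally (1+δ)^3 ≤ 1 + 5δ ≤ 1 + ε because δ ≤ min(ε/5, 1/5).
module Submission where

open import Defs
open import Data.Nat as ℕ using (ℕ; zero; suc; ⌈_/2⌉; _∸_; z≤n; s≤s)
import Data.Nat.Properties as ℕₚ
open import Data.Nat.Induction using (<-wellFounded)
open import Data.Integer using (ℤ; +_)
open import Data.Fin using (Fin)
open import Data.Maybe using (Maybe; just; nothing)
open import Data.Product using (_×_; ∃; _,_; proj₁; proj₂)
open import Data.Rational using (ℚ; 0ℚ; 1ℚ; ½; _+_; _*_; _/_; _≤_; _<_; nonNegative)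
open import Data.Rational.Properties
open import Data.Rational.Solver using (module +-*-Solver)
open import Data.Empty using (⊥-elim)
import Relation.Binary.Construct.On as On
open import Relation.Binary.PropositionalEquality using (_≡_; refl; sym; cong; subst)
open import Relation.Nullary.Decidable using (toWitness)
open import Induction.WellFounded using (Acc; WellFounded; module Subrelation)

0≤1 : 0ℚ ≤ 1ℚ
0≤1 = toWitness {a? = 0ℚ ≤? 1ℚ} _

^-distribˡ-+-* : ∀ β m n → β ^ (m ℕ.+ n) ≡ β ^ m * β ^ n
^-distribˡ-+-* β zero    n = sym (*-identityˡ (β ^ n))
^-distribˡ-+-* β (suc m) n rewrite ^-distribˡ-+-* β m n = sym (*-assoc β (β ^ m) (β ^ n))

module _ {β : ℚ} (1≤β : 1ℚ ≤ β) where

  0≤β : 0ℚ ≤ β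
  0≤β = ≤-trans 0≤1 1≤β

  β*-mono-≤ : ∀ {p q} → p ≤ q → β * p ≤ β * q
  β*-mono-≤ = *-monoˡ-≤-nonNeg β {{nonNegative 0≤β}}

  1≤^ : ∀ k → 1ℚ ≤ β ^ k
  1≤^ zero    = ≤-refl
  1≤^ (suc k) = ≤-trans 1≤β (subst (_≤ β * β ^ k) (*-identityʳ β) (β*-mono-≤ (1≤^ k)))

  ^-monoʳ-≤ : ∀ {j k} → j ℕ.≤ k → β ^ j ≤ β ^ k
  ^-monoʳ-≤ {k = k} z≤n = 1≤^ k
  ^-monoʳ-≤ (s≤s j≤k)   = β*-mono-≤ (^-monoʳ-≤ j≤k)

  ^-pred-≤ : ∀ {r} k → 1ℚ ≤ r → β ^ k < β * r → β ^ (k ∸ 1) ≤ r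
  ^-pred-≤ zero    1≤r _      = 1≤r
  ^-pred-≤ (suc k) _   βᵏ⁺¹<βr = <⇒≤ (*-cancelˡ-<-nonNeg β {{nonNegative 0≤β}} βᵏ⁺¹<βr)

IsCeilLog-minimal : ∀ {β x k m} → IsCeilLog β x k → x ≤ β ^ m → k ℕ.≤ m
IsCeilLog-minimal {m = m} (_ , below) x≤βᵐ =
  ℕₚ.≮⇒≥ (λ m<k → <-irrefl refl (<-≤-trans (below m m<k) x≤βᵐ))

module _ where
  open +-*-Solver

  cube-expand : ∀ d → (1ℚ + d) ^ 3 ≡ 1ℚ + d * (+ 3 / 1 + d * (+ 3 / 1 + d))
  cube-expand = solve 1 (λ d → (con 1ℚ :+ d) :* ((con 1ℚ :+ d) :* ((con 1ℚ :+ d) :* con 1ℚ))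
                           := con 1ℚ :+ d :* (con (+ 3 / 1) :+ d :* (con (+ 3 / 1) :+ d))) refl

  ε*⅕*5≡ε : ∀ ε → ε * (+ 1 / 5) * (+ 5 / 1) ≡ ε
  ε*⅕*5≡ε = solve 1 (λ ε → ε :* con (+ 1 / 5) :* con (+ 5 / 1) := ε) refl

cube-≤ : ∀ {d} → 0ℚ ≤ d → d ≤ + 1 / 5 → (1ℚ + d) ^ 3 ≤ 1ℚ + d * (+ 5 / 1)
cube-≤ {d} 0≤d d≤⅕ = begin
  (1ℚ + d) ^ 3                               ≡⟨ cube-expand d ⟩
  1ℚ + d * (+ 3 / 1 + d * (+ 3 / 1 + d))
    ≤⟨ +-monoʳ-≤ 1ℚ (d*-mono-≤ (+-monoʳ-≤ (+ 3 / 1) quadratic-≤)) ⟩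
  1ℚ + d * (+ 3 / 1 + + 1 / 5 * (+ 3 / 1 + + 1 / 5))
    ≤⟨ +-monoʳ-≤ 1ℚ (d*-mono-≤ (toWitness {a? = _ ≤? + 5 / 1} _)) ⟩
  1ℚ + d * (+ 5 / 1)                         ∎
  where
  open ≤-Reasoning
  d*-mono-≤ : ∀ {p q} → p ≤ q → d * p ≤ d * q
  d*-mono-≤ = *-monoˡ-≤-nonNeg d {{nonNegative 0≤d}}
  quadratic-≤ : d * (+ 3 / 1 + d) ≤ + 1 / 5 * (+ 3 / 1 + + 1 / 5)
  quadratic-≤ = ≤-trans (d*-mono-≤ (+-monoʳ-≤ (+ 3 / 1) d≤⅕))
                        (*-monoʳ-≤-nonNeg (+ 3 / 1 + + 1 / 5) d≤⅕)

δof-nonNeg : ∀ {ε} → 0ℚ ≤ ε → 0ℚ ≤ δof ε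
δof-nonNeg 0≤ε = ⊓-glb (*-monoʳ-≤-nonNeg (+ 1 / 5) 0≤ε) (toWitness {a? = 0ℚ ≤? ½} _)

δof-cube-≤ : ∀ {ε} → 0ℚ ≤ ε → ε ≤ 1ℚ → (1ℚ + δof ε) ^ 3 ≤ 1ℚ + ε
δof-cube-≤ {ε} 0≤ε ε≤1 = begin
  (1ℚ + δ) ^ 3
    ≤⟨ cube-≤ (δof-nonNeg 0≤ε) (≤-trans δ≤ε/5 (*-monoʳ-≤-nonNeg (+ 1 / 5) ε≤1)) ⟩
  1ℚ + δ * (+ 5 / 1)                    ≤⟨ +-monoʳ-≤ 1ℚ (*-monoʳ-≤-nonNeg (+ 5 / 1) δ≤ε/5) ⟩
  1ℚ + ε * (+ 1 / 5) * (+ 5 / 1)        ≡⟨ cong (λ q → 1ℚ + q) (ε*⅕*5≡ε ε) ⟩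
  1ℚ + ε                                ∎
  where
  open ≤-Reasoning
  δ = δof ε
  δ≤ε/5 : δ ≤ ε * (+ 1 / 5)
  δ≤ε/5 = p⊓q≤p _ _

no-answer⇒< : ∀ {n} {A : Mat n} {t α D r} →
  IsDist A t r → ValidAnswer A t α D nothing → D < α * r
no-answer⇒< {α = α} {D} ((x , dx≡r) , _) no = subst (λ d → D < α * d) dx≡r (no x)

⌈n/2⌉<n : ∀ {n} → 2 ℕ.≤ n → ⌈ n /2⌉ ℕ.< n
⌈n/2⌉<n (s≤s (s≤s {n = n} _)) = ℕₚ.⌈n/2⌉<n n

module _ {L U : ℕ} (3≤U∸L : 3 ℕ.≤ U ∸ L) where

  private
    h = ⌈ (U ∸ L) /2⌉

    2≤h : 2 ℕ.≤ h
    2≤h = ℕₚ.⌈n/2⌉-mono 3≤U∸L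

    h<U∸L : h ℕ.< U ∸ L
    h<U∸L = ⌈n/2⌉<n (ℕₚ.≤-trans (ℕₚ.n≤1+n 2) 3≤U∸L)

    L≤U : L ℕ.≤ U
    L≤U = ℕₚ.<⇒≤ (ℕₚ.m∸n≢0⇒n<m (λ U∸L≡0 → ℕₚ.<⇒≱ (subst (3 ℕ.≤_) U∸L≡0 3≤U∸L) z≤n))

  mid<U : mid ⟨ L , U ⟩ ℕ.< U
  mid<U = subst (mid ⟨ L , U ⟩ ℕ.<_) (ℕₚ.m+[n∸m]≡n L≤U) (ℕₚ.+-monoʳ-< L h<U∸L)

  L<mid∸1 : L ℕ.< mid ⟨ L , U ⟩ ∸ 1
  L<mid∸1 = subst (L ℕ.<_) (sym (ℕₚ.+-∸-assoc L (ℕₚ.≤-trans (s≤s z≤n) 2≤h)))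
                  (ℕₚ.m<m+n L (ℕₚ.∸-monoˡ-≤ 1 2≤h))

gap : State → ℕ
gap s = U s ∸ L s

Step-shrinks-gap : ∀ {n} {A : Mat n} {t β s s'} → Step A t β s s' → gap s' ℕ.< gap s
Step-shrinks-gap (found {Lc} {Uc} _ 3≤gap dx≤βᵐⁱᵈ ceil) =
  ℕₚ.≤-<-trans (ℕₚ.∸-monoˡ-≤ Lc (IsCeilLog-minimal ceil dx≤βᵐⁱᵈ))
               (ℕₚ.∸-monoˡ-< (mid<U {Lc} {Uc} 3≤gap) (ℕₚ.m≤m+n Lc _))
Step-shrinks-gap (notFound {Lc} {Uc} 3≤gap _) =
  ℕₚ.∸-monoʳ-< (L<mid∸1 {Lc} {Uc} 3≤gap)
               (ℕₚ.≤-trans (ℕₚ.m∸n≤m (mid ⟨ Lc , Uc ⟩) 1) (ℕₚ.<⇒≤ (mid<U {Lc} {Uc} 3≤gap)))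

Step-wellFounded : ∀ {n} (A : Mat n) t β → WellFounded (λ s' s → Step A t β s s')
Step-wellFounded A t β =
  Subrelation.wellFounded Step-shrinks-gap (On.wellFounded gap <-wellFounded)

module _ {n} {A : Mat n} {t : Vecℚ n} {β M r : ℚ} (1≤β : 1ℚ ≤ β)
         (isDist : IsDist A t r) (1≤r : 1ℚ ≤ r) (r≤M : r ≤ M) where

  Reach⇒bracket : ∀ {s} → Reach A t β M s → (β ^ L s ≤ r) × (r ≤ β ^ U s)
  Reach⇒bracket (init (M≤βᵁ , _)) = 1≤r , ≤-trans r≤M M≤βᵁ
  Reach⇒bracket (step reach (found x _ _ (dx≤βᵏ , _))) =
    proj₁ (Reach⇒bracket reach) , ≤-trans (proj₂ isDist x) dx≤βᵏ
  Reach⇒bracket (step reach (notFound {Lc} {Uc} _ no)) =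
      ^-pred-≤ 1≤β (mid ⟨ Lc , Uc ⟩) 1≤r (no-answer⇒< {A = A} {α = β} isDist no)
    , proj₂ (Reach⇒bracket reach)

  final-answer-≤β³r : ∀ {s} → Reach A t β M s → gap s ℕ.< 3 →
    ∀ {ans} → ValidAnswer A t β (β ^ suc (U s)) ans →
    ∃ (λ x → (ans ≡ just x) × (dist A t x ≤ β ^ 3 * r))
  final-answer-≤β³r reach _ {nothing} no =
    ⊥-elim (<-irrefl refl (<-≤-trans (no-answer⇒< {A = A} {α = β} isDist no)
                                     (β*-mono-≤ 1≤β (proj₂ (Reach⇒bracket reach)))))
  final-answer-≤β³r {s} reach gap<3 {just x} dx≤βᵁ⁺¹ = x , refl , (begin
    dist A t x          ≤⟨ dx≤βᵁ⁺¹ ⟩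
    β ^ suc (U s)       ≤⟨ ^-monoʳ-≤ 1≤β (s≤s U≤2+L) ⟩
    β ^ (3 ℕ.+ L s)     ≡⟨ ^-distribˡ-+-* β 3 (L s) ⟩
    β ^ 3 * β ^ L s     ≤⟨ *-monoˡ-≤-nonNeg (β ^ 3) {{nonNegative (0≤^ 3)}} (proj₁ (Reach⇒bracket reach)) ⟩
    β ^ 3 * r           ∎)
    where
    open ≤-Reasoning
    U≤2+L : U s ℕ.≤ 2 ℕ.+ L s
    U≤2+L = ℕₚ.≤-trans (ℕₚ.m≤n+m∸n (U s) (L s))
              (ℕₚ.≤-trans (ℕₚ.+-monoʳ-≤ (L s) (ℕₚ.≤-pred gap<3)) (ℕₚ.≤-reflexive (ℕₚ.+-comm (L s) 2)))
    0≤^ : ∀ k → 0ℚ ≤ β ^ k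
    0≤^ k = ≤-trans 0≤1 (1≤^ 1≤β k)

lemma3p5 : ∀ {n} (A : Mat n) (t : Vecℚ n) (M ε r : ℚ) →
    IsDist A t r → 1ℚ ≤ r → r ≤ M →
    0ℚ < ε → ε < 1ℚ →
    let β = 1ℚ + δof ε in
    (∀ s → Reach A t β M s → (β ^ L s ≤ r) × (r ≤ β ^ U s))
    × (∀ s → Reach A t β M s → Acc (λ s' s₀ → Step A t β s₀ s') s)
    × (∀ s → Reach A t β M s → U s ℕ.∸ L s ℕ.< 3 →
         ∀ (ans : Maybe (Fin n → ℤ)) → ValidAnswer A t β (β ^ ℕ.suc (U s)) ans →
         ∃ (λ x → (ans ≡ just x) × (dist A t x ≤ (1ℚ + ε) * r)))
lemma3p5 A t M ε r isDist 1≤r r≤M 0<ε ε<1 =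
    (λ _ → Reach⇒bracket 1≤β isDist 1≤r r≤M)
  , (λ s _ → Step-wellFounded A t β s)
  , final
  where
  β = 1ℚ + δof ε
  β³≤1+ε : β ^ 3 ≤ 1ℚ + ε
  β³≤1+ε = δof-cube-≤ (<⇒≤ 0<ε) (<⇒≤ ε<1)
  1≤β : 1ℚ ≤ β
  1≤β = ≤-trans (≤-reflexive (sym (+-identityʳ 1ℚ))) (+-monoʳ-≤ 1ℚ (δof-nonNeg (<⇒≤ 0<ε)))
  final : ∀ s → Reach A t β M s → gap s ℕ.< 3 →
    ∀ ans → ValidAnswer A t β (β ^ suc (U s)) ans →
    ∃ (λ x → (ans ≡ just x) × (dist A t x ≤ (1ℚ + ε) * r))
  final _ reach gap<3 _ valid with final-answer-≤β³r 1≤β isDist 1≤r r≤M reach gap<3 valid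
  ... | x , ans≡x , dx≤β³r =
    x , ans≡x , ≤-trans dx≤β³r (*-monoʳ-≤-nonNeg r {{nonNegative (≤-trans 0≤1 1≤r)}} β³≤1+ε)
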